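{- Let $n,k$ be positive integers with $n\ge 2k$ and $\gcd(n,k)=1$. Then $Q(n,k)$ is isomorphic to the circular complete graph $K_{n/k}$.
   Context: For a positive integer $n$ let $[n]=\{1,\dots,n\}$ and let $C_n$ be the cycle on $[n]$ with edges $\{i,i+1\}$ ($1\le i\le n-1$) and $\{n,1\}$. The Schrijver graph $\mathrm{SG}(n,k)$ ($n\ge 2k$) has as vertices the $k$-subsets of $[n]$ containing no two cyclically consecutive elements, two vertices adjacent iff they are disjoint. An arc of $C_n$ is a set $\{i,i+1,\dots,i+m-1\}$ (addition mod $n$) with $1\le m\le n-1$. A set $U\subseteq[n]$ is well-spread if for any two arcs $A,B$ with $|A|=|B|$ we have $\big||A\cap U|-|B\cap U|\big|\le 1$. $Q(n,k)$ is the induced subgraph of $\mathrm{SG}(n,k)$ on all well-spread $k$-subsets of $[n]$. The circular complete graph $K_{n/k}$ has vertex set $\{0,1,\dots,n-1\}$, with $\{i,j\}$ an edge iff $k\le |i-j|\le n-k$. -}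

module Defs where

open import Data.Bool using (Bool; true; false)
open import Data.Nat using (ℕ; zero; suc; _+_; _∸_; _≤_; ∣_-_∣)
open import Data.Nat.DivMod using (_%_; m%n<n)
open import Data.Fin using (Fin; toℕ; fromℕ<)
open import Data.Fin.Subset using (Subset; _∩_; ∣_∣; Empty)
open import Data.Vec using (lookup)
open import Data.Product using (_×_; ∃)
open import Relation.Binary.PropositionalEquality using (_≡_)
open import Relation.Nullary using (¬_)
open import Function.Bundles using (_⇔_)

-- Convention: the ground set [n] = {1,…,n} is represented by Fin n = {0,…,n-1}
-- (element i of [n] ↔ i-1); the cycle structure (i ↦ i+1 mod n) is preserved.

at : ∀ {n} → Subset n → ℕ → Bool
at {zero}  U j = false
at {suc n} U j = lookup U (fromℕ< (m%n<n j (suc n)))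

arcCount : ∀ {n} → Subset n → ℕ → ℕ → ℕ
arcCount U i zero    = 0
arcCount U i (suc m) with at U (i + m)
... | true  = suc (arcCount U i m)
... | false = arcCount U i m

WellSpread : ∀ {n} → Subset n → Set
WellSpread {n} U = ∀ (i j : Fin n) (m : ℕ) → 1 ≤ m → m ≤ n ∸ 1 →
  ∣ arcCount U (toℕ i) m - arcCount U (toℕ j) m ∣ ≤ 1

NoCyclicConsecutive : ∀ {n} → Subset n → Set
NoCyclicConsecutive {n} U = ∀ (i : Fin n) →
  ¬ (at U (toℕ i) ≡ true × at U (suc (toℕ i)) ≡ true)

-- Vertices of Q(n,k): well-spread k-subsets with no two cyclically
-- consecutive elements (i.e. well-spread vertices of SG(n,k)).
IsQVertex : (n k : ℕ) → Subset n → Set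
IsQVertex n k U = ∣ U ∣ ≡ k × NoCyclicConsecutive U × WellSpread U

-- Adjacency in SG(n,k) (hence in the induced subgraph Q(n,k)): disjointness.
QAdj : ∀ {n} → Subset n → Subset n → Set
QAdj U V = Empty (U ∩ V)

KAdj : (n k : ℕ) → Fin n → Fin n → Set
KAdj n k i j = k ≤ ∣ toℕ i - toℕ j ∣ × ∣ toℕ i - toℕ j ∣ ≤ n ∸ k

record KIsoQ (n k : ℕ) : Set where
  field
    g          : Fin n → Subset n
    g-vertex   : ∀ i → IsQVertex n k (g i)
    g-injective : ∀ i j → g i ≡ g j → i ≡ j
    g-onto     : ∀ U → IsQVertex n k U → ∃ λ i → g i ≡ U
    g-adj      : ∀ i j → KAdj n k i j ⇔ QAdj (g i) (g j)

QIsoK : (n k : ℕ) → Set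
QIsoK n k = KIsoQ n k

-- The vertex i of K_{n/k} goes to the mechanical set g(i) = { x : ⌊((x + 1) k + i) / n⌋ > ⌊(x k + i) / n⌋ }.
-- It meets the arc of length m starting at x in ⌊((x k + i) mod n + m k) / n⌋ points, which is ⌊m k / n⌋ or
-- one more, so g(i) is a well-spread k-set without consecutive points. With r = (x k + i) mod n, x lies in
-- g(i) iff r is in the top arc [n - k, n), and in g(i + d) iff r + d mod n is; since x ↦ x k is onto ℤ/n,
-- g(i) and g(i + d) are disjoint iff the top arc and its rotation by d are, i.e. iff k ≤ d ≤ n - k.
-- Conversely, let U be well-spread with prefix counts F. As n ∤ m k for 0 < m < n, every arc of length m
-- meets U in ⌊m k / n⌋ or ⌈m k / n⌉ points: otherwise all n arcs starting at 0, m, …, (n - 1) m would be too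
-- heavy (or too light), whereas together they tile [0, n m), which holds m k points. Hence the numbers
-- F x · n - x k (x < n) lie in a window of width less than n, and for their maximum s, F x = ⌊(x k + s) / n⌋,
-- i.e. U = g(s).

module Submission where

open import Defs
open import Data.Bool using (Bool; true; false)
open import Data.Bool.Properties using (T-≡)
open import Data.Empty using (⊥-elim)
open import Data.Fin using (Fin; toℕ; fromℕ<) renaming (zero to fzero; suc to fsuc)
open import Data.Fin.Properties using (toℕ<n; toℕ-injective; toℕ-fromℕ<; fromℕ<-toℕ; fromℕ<-cong)
open import Data.Fin.Subset using (Subset; ∣_∣; _∈_; _∩_; Empty)
open import Data.Fin.Subset.Properties using (x∈p∩q⁺; x∈p∩q⁻; ∩-comm)
open import Data.List using (upTo)
open import Data.List.Extrema.Nat using (argmax; argmax-all; f[xs]≤f[argmax])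
open import Data.List.Membership.Propositional.Properties using (∈-upTo⁺)
open import Data.List.Relation.Unary.All as All using ()
open import Data.List.Relation.Unary.All.Properties using (all-upTo)
open import Data.Nat
open import Data.Nat.Coprimality using (Coprime; coprime-Bézout; coprime-divisor; gcd≡1⇒coprime)
open import Data.Nat.DivMod
open import Data.Nat.Divisibility using (divides; divides-refl; ∣⇒≤)
open import Data.Nat.GCD using (gcd; module Bézout)
open import Data.Nat.Properties
open import Algebra.Properties.CommutativeSemigroup +-commutativeSemigroup using (xy∙z≈xz∙y; x∙yz≈y∙xz)
open import Data.Nat.Tactic.RingSolver using (solve-∀)
open import Data.Product using (_×_; _,_; ∃)
open import Data.Sum using (inj₁; inj₂)
open import Data.Vec using (Vec; []; _∷_; lookup; tabulate)
open import Data.Vec.Properties using (lookup∘tabulate; tabulate∘lookup; tabulate-cong; []=⇒lookup; lookup⇒[]=)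
open import Function using (_∘_)
open import Function.Bundles using (_⇔_; mk⇔; Equivalence)
import Function.Properties.Equivalence as ⇔
open import Relation.Binary using (tri<; tri≈; tri>)
open import Relation.Binary.PropositionalEquality
open import Relation.Nullary using (¬_; yes; no)
open import Relation.Nullary.Decidable using (decidable-stable; _×-dec_)
open import Relation.Nullary.Reflects using (ofʸ; ofⁿ)

bit : Bool → ℕ
bit true  = 1
bit false = 0

bit-injective : ∀ {a b} → bit a ≡ bit b → a ≡ b
bit-injective {true}  {true}  _ = refl
bit-injective {false} {false} _ = refl

∣m-n∣≤1 : ∀ {m n} → m ≤ suc n → n ≤ suc m → ∣ m - n ∣ ≤ 1
∣m-n∣≤1 {zero}  {n}     _       n≤1     = n≤1
∣m-n∣≤1 {suc m} {zero}  m≤0     _       = m≤0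
∣m-n∣≤1 {suc m} {suc n} (s≤s p) (s≤s q) = ∣m-n∣≤1 p q

module _ (n : ℕ) .{{_ : NonZero n}} where

  /-unique : ∀ {m} q → q * n ≤ m → m < suc q * n → m / n ≡ q
  /-unique {m} q lo hi = ≤-antisym (s≤s⁻¹ (m<n*o⇒m/o<n hi)) (begin
    q          ≡⟨ m*n/n≡m q n ⟨
    q * n / n  ≤⟨ /-monoˡ-≤ n lo ⟩
    m / n      ∎)
    where open ≤-Reasoning

  [m+o]/n≡[m%n+o]/n+m/n : ∀ m o → (m + o) / n ≡ (m % n + o) / n + m / n
  [m+o]/n≡[m%n+o]/n+m/n m o = begin
    (m + o) / n                      ≡⟨ cong (λ z → (z + o) / n) (m≡m%n+[m/n]*n m n) ⟩
    (m % n + m / n * n + o) / n      ≡⟨ cong (_/ n) (xy∙z≈xz∙y (m % n) (m / n * n) o) ⟩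
    (m % n + o + m / n * n) / n      ≡⟨ +-distrib-/-∣ʳ (m % n + o) (divides-refl (m / n)) ⟩
    (m % n + o) / n + m / n * n / n  ≡⟨ cong ((m % n + o) / n +_) (m*n/n≡m (m / n) n) ⟩
    (m % n + o) / n + m / n          ∎
    where open ≡-Reasoning

  [r+k]/n≡bit[n≤r+k] : ∀ {r k} → r < n → k ≤ n → (r + k) / n ≡ bit (n ≤ᵇ r + k)
  [r+k]/n≡bit[n≤r+k] {r} {k} r<n k≤n with n ≤ᵇ r + k | ≤ᵇ-reflects-≤ n (r + k)
  ... | true  | ofʸ n≤r+k = /-unique 1 (subst (_≤ r + k) (sym (*-identityˡ n)) n≤r+k)
                                (subst (r + k <_) (cong (n +_) (sym (*-identityˡ n))) (+-mono-<-≤ r<n k≤n))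
  ... | false | ofⁿ n≰r+k = m<n⇒m/n≡0 (≰⇒> n≰r+k)

  [r+m]/n≤1+m/n : ∀ {r} m → r < n → (r + m) / n ≤ suc (m / n)
  [r+m]/n≤1+m/n {r} m r<n = begin
    (r + m) / n              ≡⟨ cong (_/ n) (+-comm r m) ⟩
    (m + r) / n              ≡⟨ [m+o]/n≡[m%n+o]/n+m/n m r ⟩
    (m % n + r) / n + m / n  ≤⟨ +-monoˡ-≤ (m / n) (s≤s⁻¹ (m<n*o⇒m/o<n {n = 2} carry<2n)) ⟩
    1 + m / n                ∎
    where
    open ≤-Reasoning
    carry<2n : m % n + r < 2 * n
    carry<2n = subst (m % n + r <_) (cong (n +_) (sym (+-identityʳ n))) (+-mono-< (m%n<n m n) r<n)

  [r+n*k]/n≡k : ∀ {r} k → r < n → (r + n * k) / n ≡ k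
  [r+n*k]/n≡k {r} k r<n = /-unique k
    (subst (_≤ r + n * k) (*-comm n k) (m≤n+m (n * k) r))
    (subst (r + n * k <_) (cong (n +_) (*-comm n k)) (+-monoˡ-< (n * k) r<n))

  [m%n+o]%n≡[m+o]%n : ∀ m o → (m % n + o) % n ≡ (m + o) % n
  [m%n+o]%n≡[m+o]%n m o = begin
    (m % n + o) % n            ≡⟨ %-distribˡ-+ (m % n) o n ⟩
    (m % n % n + o % n) % n    ≡⟨ cong (λ z → (z + o % n) % n) (m%n%n≡m%n m n) ⟩
    (m % n + o % n) % n        ≡⟨ %-distribˡ-+ m o n ⟨
    (m + o) % n                ∎
    where open ≡-Reasoning

  [m%n*o]%n≡[m*o]%n : ∀ m o → (m % n * o) % n ≡ (m * o) % n
  [m%n*o]%n≡[m*o]%n m o = begin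
    (m % n * o) % n            ≡⟨ %-distribˡ-* (m % n) o n ⟩
    (m % n % n * (o % n)) % n  ≡⟨ cong (λ z → (z * (o % n)) % n) (m%n%n≡m%n m n) ⟩
    (m % n * (o % n)) % n      ≡⟨ %-distribˡ-* m o n ⟨
    (m * o) % n                ∎
    where open ≡-Reasoning

  m%n+n≤m : ∀ {m} → n ≤ m → m % n + n ≤ m
  m%n+n≤m {m} n≤m = begin
    m % n + n          ≤⟨ +-monoʳ-≤ (m % n) (subst (_≤ m / n * n) (+-identityʳ n) (*-monoˡ-≤ n (m≥n⇒m/n>0 n≤m))) ⟩
    m % n + m / n * n  ≡⟨ m≡m%n+[m/n]*n m n ⟨
    m                  ∎
    where open ≤-Reasoning

module _ {n : ℕ} (U : Subset (suc n)) where

  at-% : ∀ {a b} → a % suc n ≡ b % suc n → at U a ≡ at U b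
  at-% a≡b = cong (lookup U) (fromℕ<-cong _ _ a≡b _ _)

  lookup≡at : ∀ j → lookup U j ≡ at U (toℕ j)
  lookup≡at j = cong (lookup U) (begin
    j                            ≡⟨ fromℕ<-toℕ j (toℕ<n j) ⟨
    fromℕ< (toℕ<n j)             ≡⟨ fromℕ<-cong _ _ (m<n⇒m%n≡m (toℕ<n j)) _ _ ⟨
    fromℕ< (m%n<n (toℕ j) (suc n)) ∎)
    where open ≡-Reasoning

  arcCount-suc : ∀ i m → arcCount U i (suc m) ≡ bit (at U (i + m)) + arcCount U i m
  arcCount-suc i m with at U (i + m)
  ... | true  = refl
  ... | false = refl

  arcCount-+ : ∀ i m o → arcCount U i (m + o) ≡ arcCount U i m + arcCount U (i + m) o
  arcCount-+ i m zero    = trans (cong (arcCount U i) (+-identityʳ m)) (sym (+-identityʳ _))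
  arcCount-+ i m (suc o) = begin
    arcCount U i (m + suc o)                                          ≡⟨ cong (arcCount U i) (+-suc m o) ⟩
    arcCount U i (suc (m + o))                                        ≡⟨ arcCount-suc i (m + o) ⟩
    bit (at U (i + (m + o))) + arcCount U i (m + o)                   ≡⟨ cong₂ _+_ (cong (bit ∘ at U) (sym (+-assoc i m o))) (arcCount-+ i m o) ⟩
    bit (at U (i + m + o)) + (arcCount U i m + arcCount U (i + m) o)  ≡⟨ x∙yz≈y∙xz (bit (at U (i + m + o))) (arcCount U i m) _ ⟩
    arcCount U i m + (bit (at U (i + m + o)) + arcCount U (i + m) o)  ≡⟨ cong (arcCount U i m +_) (arcCount-suc (i + m) o) ⟨
    arcCount U i m + arcCount U (i + m) (suc o)                       ∎
    where open ≡-Reasoning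

  arcCount-∷ : ∀ i m → arcCount U i (suc m) ≡ bit (at U i) + arcCount U (suc i) m
  arcCount-∷ i m = begin
    arcCount U i (1 + m)                           ≡⟨ arcCount-+ i 1 m ⟩
    arcCount U i 1 + arcCount U (i + 1) m          ≡⟨ cong (_+ arcCount U (i + 1) m) (arcCount-suc i 0) ⟩
    bit (at U (i + 0)) + 0 + arcCount U (i + 1) m  ≡⟨ cong₂ (λ a b → bit (at U a) + 0 + arcCount U b m) (+-identityʳ i) (+-comm i 1) ⟩
    bit (at U i) + 0 + arcCount U (suc i) m        ≡⟨ cong (_+ arcCount U (suc i) m) (+-identityʳ (bit (at U i))) ⟩
    bit (at U i) + arcCount U (suc i) m            ∎
    where open ≡-Reasoning

  arcCount-% : ∀ {a b} m → a % suc n ≡ b % suc n → arcCount U a m ≡ arcCount U b m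
  arcCount-% zero    a≡b = refl
  arcCount-% {a} {b} (suc m) a≡b = begin
    arcCount U a (suc m)                   ≡⟨ arcCount-suc a m ⟩
    bit (at U (a + m)) + arcCount U a m    ≡⟨ cong₂ _+_ (cong bit (at-% {a + m} {b + m} a+m≡b+m)) (arcCount-% m a≡b) ⟩
    bit (at U (b + m)) + arcCount U b m    ≡⟨ arcCount-suc b m ⟨
    arcCount U b (suc m)                   ∎
    where
    open ≡-Reasoning
    a+m≡b+m : (a + m) % suc n ≡ (b + m) % suc n
    a+m≡b+m = begin
      (a + m) % suc n          ≡⟨ [m%n+o]%n≡[m+o]%n (suc n) a m ⟨
      (a % suc n + m) % suc n  ≡⟨ cong (λ z → (z + m) % suc n) a≡b ⟩
      (b % suc n + m) % suc n  ≡⟨ [m%n+o]%n≡[m+o]%n (suc n) b m ⟩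
      (b + m) % suc n          ∎

  ∣U∣≡arcCount : ∣ U ∣ ≡ arcCount U 0 (suc n)
  ∣U∣≡arcCount = count≡arcCount U 0 lookup≡at
    where
    count≡arcCount : ∀ {N} (v : Vec Bool N) o → (∀ j → lookup v j ≡ at U (o + toℕ j)) → ∣ v ∣ ≡ arcCount U o N
    count≡arcCount []      o _      = refl
    count≡arcCount {suc N} (b ∷ v) o v≡U = begin
      ∣ b ∷ v ∣                          ≡⟨ ∣∷∣ b ⟩
      bit b + ∣ v ∣                      ≡⟨ cong₂ _+_ (cong bit (trans (v≡U fzero) (cong (at U) (+-identityʳ o))))
                                                      (count≡arcCount v (suc o) λ j → trans (v≡U (fsuc j)) (cong (at U) (+-suc o (toℕ j)))) ⟩
      bit (at U o) + arcCount U (suc o) N ≡⟨ arcCount-∷ o N ⟨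
      arcCount U o (suc N)                ∎
      where
      open ≡-Reasoning
      ∣∷∣ : ∀ b → ∣ b ∷ v ∣ ≡ bit b + ∣ v ∣
      ∣∷∣ true  = refl
      ∣∷∣ false = refl

  arcCount-[1+J]*m : ∀ J m → arcCount U 0 (suc J * m) ≡ arcCount U 0 (J * m) + arcCount U (J * m) m
  arcCount-[1+J]*m J m = trans (cong (arcCount U 0) (+-comm m (J * m))) (arcCount-+ 0 (J * m) m)

  arcCount-tiling-< : ∀ a c m J → (∀ y → arcCount U y m * a < c) → arcCount U 0 (J * m) * a + J ≤ J * c
  arcCount-tiling-< a c m zero    _      = z≤n
  arcCount-tiling-< a c m (suc J) arcs<c = begin
    arcCount U 0 (suc J * m) * a + suc J                 ≡⟨ cong (λ z → z * a + suc J) (arcCount-[1+J]*m J m) ⟩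
    (arcCount U 0 (J * m) + arcCount U (J * m) m) * a + suc J
                                                         ≡⟨ regroup (arcCount U 0 (J * m)) (arcCount U (J * m) m) a J ⟩
    (arcCount U 0 (J * m) * a + J) + suc (arcCount U (J * m) m * a)
                                                         ≤⟨ +-mono-≤ (arcCount-tiling-< a c m J arcs<c) (arcs<c (J * m)) ⟩
    J * c + c                                            ≡⟨ +-comm (J * c) c ⟩
    suc J * c                                            ∎
    where
    open ≤-Reasoning
    regroup : ∀ f g a J → (f + g) * a + suc J ≡ (f * a + J) + suc (g * a)
    regroup = solve-∀

  arcCount-tiling-> : ∀ a c m J → (∀ y → c < arcCount U y m * a) → J * c + J ≤ arcCount U 0 (J * m) * a
  arcCount-tiling-> a c m zero    _      = z≤n
  arcCount-tiling-> a c m (suc J) c<arcs = begin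
    suc J * c + suc J                                    ≡⟨ regroup c J ⟩
    (J * c + J) + suc c                                  ≤⟨ +-mono-≤ (arcCount-tiling-> a c m J c<arcs) (c<arcs (J * m)) ⟩
    arcCount U 0 (J * m) * a + arcCount U (J * m) m * a  ≡⟨ *-distribʳ-+ a (arcCount U 0 (J * m)) _ ⟨
    (arcCount U 0 (J * m) + arcCount U (J * m) m) * a    ≡⟨ cong (_* a) (arcCount-[1+J]*m J m) ⟨
    arcCount U 0 (suc J * m) * a                         ∎
    where
    open ≤-Reasoning
    regroup : ∀ c J → suc J * c + suc J ≡ (J * c + J) + suc c
    regroup = solve-∀

≡-by-prefixCounts : ∀ {n} (U V : Subset (suc n)) → (∀ x → x ≤ suc n → arcCount U 0 x ≡ arcCount V 0 x) → U ≡ V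
≡-by-prefixCounts U V U≗V = begin
  U                ≡⟨ tabulate∘lookup U ⟨
  tabulate (lookup U)  ≡⟨ tabulate-cong lookupU≗V ⟩
  tabulate (lookup V)  ≡⟨ tabulate∘lookup V ⟩
  V                ∎
  where
  open ≡-Reasoning
  lookupU≗V : ∀ j → lookup U j ≡ lookup V j
  lookupU≗V j = begin
    lookup U j      ≡⟨ lookup≡at U j ⟩
    at U (toℕ j)    ≡⟨ bit-injective (+-cancelʳ-≡ _ _ _ (begin
      bit (at U x) + arcCount U 0 x  ≡⟨ arcCount-suc U 0 x ⟨
      arcCount U 0 (suc x)           ≡⟨ U≗V (suc x) (toℕ<n j) ⟩
      arcCount V 0 (suc x)           ≡⟨ arcCount-suc V 0 x ⟩
      bit (at V x) + arcCount V 0 x  ≡⟨ cong (bit (at V x) +_) (U≗V x (<⇒≤ (toℕ<n j))) ⟨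
      bit (at V x) + arcCount U 0 x  ∎)) ⟩
    at V (toℕ j)    ≡⟨ lookup≡at V j ⟨
    lookup V j      ∎
    where x = toℕ j

module Mechanical (n' k : ℕ) where

  n : ℕ
  n = suc n'

  residue : ℕ → ℕ → ℕ
  residue s x = (x * k + s) % n

  member : ℕ → ℕ → Bool
  member s x = n ≤ᵇ residue s x + k

  mechanical : ℕ → Subset n
  mechanical s = tabulate (member s ∘ toℕ)

  residue-+ : ∀ s x m → residue s (x + m) ≡ (residue s x + m * k) % n
  residue-+ s x m = begin
    ((x + m) * k + s) % n          ≡⟨ cong (_% n) (expand x m k s) ⟩
    (x * k + s + m * k) % n        ≡⟨ [m%n+o]%n≡[m+o]%n n (x * k + s) (m * k) ⟨
    (residue s x + m * k) % n      ∎
    where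
    open ≡-Reasoning
    expand : ∀ x m k s → (x + m) * k + s ≡ x * k + s + m * k
    expand = solve-∀

  residue-shift : ∀ s d x → residue (s + d) x ≡ (residue s x + d) % n
  residue-shift s d x = begin
    (x * k + (s + d)) % n   ≡⟨ cong (_% n) (+-assoc (x * k) s d) ⟨
    (x * k + s + d) % n     ≡⟨ [m%n+o]%n≡[m+o]%n n (x * k + s) d ⟨
    (residue s x + d) % n   ∎
    where open ≡-Reasoning

  residue-% : ∀ s x → residue s (x % n) ≡ residue s x
  residue-% s x = begin
    (x % n * k + s) % n         ≡⟨ [m%n+o]%n≡[m+o]%n n (x % n * k) s ⟨
    ((x % n * k) % n + s) % n   ≡⟨ cong (λ z → (z + s) % n) ([m%n*o]%n≡[m*o]%n n x k) ⟩
    ((x * k) % n + s) % n       ≡⟨ [m%n+o]%n≡[m+o]%n n (x * k) s ⟩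
    (x * k + s) % n             ∎
    where open ≡-Reasoning

  at-mechanical : ∀ s x → at (mechanical s) x ≡ member s x
  at-mechanical s x = begin
    lookup (mechanical s) (fromℕ< (m%n<n x n))  ≡⟨ lookup∘tabulate (member s ∘ toℕ) (fromℕ< (m%n<n x n)) ⟩
    member s (toℕ (fromℕ< (m%n<n x n)))         ≡⟨ cong (member s) (toℕ-fromℕ< (m%n<n x n)) ⟩
    member s (x % n)                            ≡⟨ cong (λ r → n ≤ᵇ r + k) (residue-% s x) ⟩
    member s x                                  ∎
    where open ≡-Reasoning

  module _ (k≤n : k ≤ n) where

    arcCount-mechanical : ∀ s i m → arcCount (mechanical s) i m ≡ (residue s i + m * k) / n
    arcCount-mechanical s i zero = sym (begin
      (residue s i + 0) / n   ≡⟨ cong (_/ n) (+-identityʳ (residue s i)) ⟩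
      residue s i / n         ≡⟨ m<n⇒m/n≡0 (m%n<n (i * k + s) n) ⟩
      0                       ∎)
      where open ≡-Reasoning
    arcCount-mechanical s i (suc m) = begin
      arcCount (mechanical s) i (suc m)                      ≡⟨ arcCount-suc (mechanical s) i m ⟩
      bit (at (mechanical s) (i + m)) + arcCount (mechanical s) i m
                                                             ≡⟨ cong₂ _+_ (cong bit (at-mechanical s (i + m))) (arcCount-mechanical s i m) ⟩
      bit (n ≤ᵇ residue s (i + m) + k) + (r + m * k) / n     ≡⟨ cong (λ z → bit (n ≤ᵇ z + k) + (r + m * k) / n) (residue-+ s i m) ⟩
      bit (n ≤ᵇ (r + m * k) % n + k) + (r + m * k) / n       ≡⟨ cong (_+ (r + m * k) / n) ([r+k]/n≡bit[n≤r+k] n (m%n<n (r + m * k) n) k≤n) ⟨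
      ((r + m * k) % n + k) / n + (r + m * k) / n            ≡⟨ [m+o]/n≡[m%n+o]/n+m/n n (r + m * k) k ⟨
      (r + m * k + k) / n                                    ≡⟨ cong (_/ n) (regroup r m k) ⟩
      (r + suc m * k) / n                                    ∎
      where
      open ≡-Reasoning
      r = residue s i
      regroup : ∀ r m k → r + m * k + k ≡ r + suc m * k
      regroup = solve-∀

    ∣mechanical∣ : ∀ {s} → s < n → ∣ mechanical s ∣ ≡ k
    ∣mechanical∣ {s} s<n = begin
      ∣ mechanical s ∣                        ≡⟨ ∣U∣≡arcCount (mechanical s) ⟩
      arcCount (mechanical s) 0 n             ≡⟨ arcCount-mechanical s 0 n ⟩
      (s % n + n * k) / n                     ≡⟨ cong (λ z → (z + n * k) / n) (m<n⇒m%n≡m s<n) ⟩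
      (s + n * k) / n                         ≡⟨ [r+n*k]/n≡k n k s<n ⟩
      k                                       ∎
      where open ≡-Reasoning

    mechanical-wellSpread : ∀ s → WellSpread (mechanical s)
    mechanical-wellSpread s i j m _ _ = ∣m-n∣≤1 (≤-trans (upper i) (s≤s (lower j))) (≤-trans (upper j) (s≤s (lower i)))
      where
      lower : ∀ i → m * k / n ≤ arcCount (mechanical s) (toℕ i) m
      lower i = subst (m * k / n ≤_) (sym (arcCount-mechanical s (toℕ i) m)) (/-monoˡ-≤ n (m≤n+m (m * k) (residue s (toℕ i))))
      upper : ∀ i → arcCount (mechanical s) (toℕ i) m ≤ suc (m * k / n)
      upper i = subst (_≤ suc (m * k / n)) (sym (arcCount-mechanical s (toℕ i) m)) ([r+m]/n≤1+m/n n (m * k) (m%n<n (toℕ i * k + s) n))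

  mechanical-noCyclicConsecutive : 2 * k ≤ n → ∀ s → NoCyclicConsecutive (mechanical s)
  mechanical-noCyclicConsecutive 2k≤n s i (x∈U , 1+x∈U) = <-irrefl refl (begin-strict
    2                                              ≡⟨ cong₂ (λ a b → bit a + (bit b + 0)) x∈U 1+x∈U ⟨
    bit (at U x) + (bit (at U (suc x)) + 0)        ≡⟨ cong (bit (at U x) +_) (arcCount-∷ U (suc x) 0) ⟨
    bit (at U x) + arcCount U (suc x) 1            ≡⟨ arcCount-∷ U x 1 ⟨
    arcCount U x 2                                 ≡⟨ arcCount-mechanical (≤-trans (m≤n*m k 2) 2k≤n) s x 2 ⟩
    (residue s x + 2 * k) / n                      <⟨ m<n*o⇒m/o<n {n = 2} r+2k<2n ⟩
    2                                              ∎)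
    where
    open ≤-Reasoning
    U = mechanical s
    x = toℕ i
    r+2k<2n : residue s x + 2 * k < 2 * n
    r+2k<2n = subst (residue s x + 2 * k <_) (cong (n +_) (sym (+-identityʳ n)))
                    (+-mono-<-≤ (m%n<n (x * k + s) n) 2k≤n)

  module _ (coprime : Coprime n k) where

    *k-surjective : ∀ r → ∃ λ c → (c * k) % n ≡ r % n
    *k-surjective r with coprime-Bézout coprime
    ... | Bézout.-+ x y 1+xn≡yk = y * r , (begin
      (y * r * k) % n        ≡⟨ cong (_% n) (trans (swap y r k) (cong (r *_) (sym 1+xn≡yk))) ⟩
      (r * (1 + x * n)) % n  ≡⟨ cong (_% n) (expand r x n) ⟩
      (r + r * x * n) % n    ≡⟨ [m+kn]%n≡m%n r (r * x) n ⟩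
      r % n                  ∎)
      where
      open ≡-Reasoning
      swap : ∀ y r k → y * r * k ≡ r * (y * k)
      swap = solve-∀
      expand : ∀ r x n → r * (1 + x * n) ≡ r + r * x * n
      expand = solve-∀
    -- Here y k ≡ -1 (mod n), so y (n - 1) inverts k.
    ... | Bézout.+- x y 1+yk≡xn = y * n' * r , (begin
      (y * n' * r * k) % n             ≡⟨ [m+kn]%n≡m%n (y * n' * r * k) r n ⟨
      (y * n' * r * k + r * n) % n     ≡⟨ cong (_% n) (regroup y n' r k) ⟩
      (r + n' * r * (1 + y * k)) % n   ≡⟨ cong (λ z → (r + n' * r * z) % n) 1+yk≡xn ⟩
      (r + n' * r * (x * n)) % n       ≡⟨ cong (_% n) (cong (r +_) (*-assoc (n' * r) x n)) ⟨
      (r + n' * r * x * n) % n         ≡⟨ [m+kn]%n≡m%n r (n' * r * x) n ⟩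
      r % n                            ∎)
      where
      open ≡-Reasoning
      regroup : ∀ y n' r k → y * n' * r * k + r * suc n' ≡ r + n' * r * (1 + y * k)
      regroup = solve-∀

    residue-surjective : ∀ {s t} → s ≤ n → t < n → ∃ λ (x : Fin n) → residue s (toℕ x) ≡ t
    residue-surjective {s} {t} s≤n t<n with *k-surjective (t + (n ∸ s))
    ... | c , ck≡t+n-s = fromℕ< (m%n<n c n) , (begin
      residue s (toℕ (fromℕ< (m%n<n c n)))   ≡⟨ cong (residue s) (toℕ-fromℕ< (m%n<n c n)) ⟩
      residue s (c % n)                      ≡⟨ residue-% s c ⟩
      (c * k + s) % n                        ≡⟨ [m%n+o]%n≡[m+o]%n n (c * k) s ⟨
      ((c * k) % n + s) % n                  ≡⟨ cong (λ z → (z + s) % n) ck≡t+n-s ⟩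
      ((t + (n ∸ s)) % n + s) % n            ≡⟨ [m%n+o]%n≡[m+o]%n n (t + (n ∸ s)) s ⟩
      (t + (n ∸ s) + s) % n                  ≡⟨ cong (_% n) (trans (+-assoc t (n ∸ s) s) (cong (t +_) (m∸n+n≡m s≤n))) ⟩
      (t + n) % n                            ≡⟨ [m+n]%n≡m%n t n ⟩
      t % n                                  ≡⟨ m<n⇒m%n≡m t<n ⟩
      t                                      ∎)
      where open ≡-Reasoning

  Top : ℕ → Set
  Top r = n ≤ r + k

  ∈mechanical⇔ : ∀ {s x} → x ∈ mechanical s ⇔ Top (residue s (toℕ x))
  ∈mechanical⇔ {s} {x} = mk⇔
    (λ x∈ → ≤ᵇ⇒≤ n _ (Equivalence.from T-≡ (trans (sym (lookup∘tabulate (member s ∘ toℕ) x)) ([]=⇒lookup x∈))))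
    (λ top → lookup⇒[]= x (mechanical s) (trans (lookup∘tabulate (member s ∘ toℕ) x) (Equivalence.to T-≡ (≤⇒≤ᵇ top))))

  Top-n' : 1 ≤ k → Top n'
  Top-n' 1≤k = subst (_≤ n' + k) (+-comm n' 1) (+-monoʳ-≤ n' 1≤k)

  [n'+1+e]%n≡e : ∀ {e} → e < n → (n' + suc e) % n ≡ e
  [n'+1+e]%n≡e {e} e<n = begin
    (n' + suc e) % n  ≡⟨ cong (_% n) (trans (+-suc n' e) (trans (cong suc (+-comm n' e)) (sym (+-suc e n')))) ⟩
    (e + n) % n       ≡⟨ [m+n]%n≡m%n e n ⟩
    e % n             ≡⟨ m<n⇒m%n≡m e<n ⟩
    e                 ∎
    where open ≡-Reasoning

  Top-rotate-disjoint : ∀ {r d} → r < n → k ≤ d → d + k ≤ n → Top r → ¬ Top ((r + d) % n)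
  Top-rotate-disjoint {r} {d} r<n k≤d d+k≤n top-r top-r+d = <-irrefl refl (begin-strict
    n + n                  ≤⟨ +-monoˡ-≤ n top-r+d ⟩
    (r + d) % n + k + n    ≡⟨ xy∙z≈xz∙y ((r + d) % n) k n ⟩
    (r + d) % n + n + k    ≤⟨ +-monoˡ-≤ k (m%n+n≤m n (≤-trans top-r (+-monoʳ-≤ r k≤d))) ⟩
    r + d + k              ≡⟨ +-assoc r d k ⟩
    r + (d + k)            <⟨ +-mono-<-≤ r<n d+k≤n ⟩
    n + n                  ∎)
    where open ≤-Reasoning

  Top-rotate-meets-near : k ≤ n → ∀ {d} → d < k → Top (n ∸ k) × Top ((n ∸ k + d) % n)
  Top-rotate-meets-near k≤n {d} d<k =
    ≤-reflexive (sym (m∸n+n≡m k≤n)) , subst (λ z → n ≤ z + k) (sym (m<n⇒m%n≡m n-k+d<n)) (begin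
    n                ≡⟨ m∸n+n≡m k≤n ⟨
    n ∸ k + k        ≤⟨ +-monoˡ-≤ k (m≤m+n (n ∸ k) d) ⟩
    n ∸ k + d + k    ∎)
    where
    open ≤-Reasoning
    n-k+d<n : n ∸ k + d < n
    n-k+d<n = begin-strict
      n ∸ k + d   <⟨ +-monoʳ-< (n ∸ k) d<k ⟩
      n ∸ k + k   ≡⟨ m∸n+n≡m k≤n ⟩
      n           ∎

  Top-rotate-meets-far : 1 ≤ k → k ≤ n → ∀ {d} → n ∸ k < d → d < n → Top n' × Top ((n' + d) % n)
  Top-rotate-meets-far 1≤k k≤n {suc e} n-k<d d<n =
    Top-n' 1≤k , subst (λ z → n ≤ z + k) (sym ([n'+1+e]%n≡e (<-trans (n<1+n e) d<n))) (begin
    n            ≡⟨ m∸n+n≡m k≤n ⟨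
    n ∸ k + k    ≤⟨ +-monoˡ-≤ k (s≤s⁻¹ n-k<d) ⟩
    e + k        ∎)
    where open ≤-Reasoning

  Top-rotate-meets : 1 ≤ k → k ≤ n → ∀ {d} → d < n → ¬ (k ≤ d × d ≤ n ∸ k) →
                     ∃ λ r → r < n × Top r × Top ((r + d) % n)
  Top-rotate-meets 1≤k k≤n {d} d<n ¬k≤d≤n-k with k ≤? d
  ... | no  k≰d = n ∸ k , ∸-monoʳ-< 1≤k k≤n , Top-rotate-meets-near k≤n (≰⇒> k≰d)
  ... | yes k≤d = n' , ≤-refl , Top-rotate-meets-far 1≤k k≤n (≰⇒> λ d≤n-k → ¬k≤d≤n-k (k≤d , d≤n-k)) d<n

  Top-rotate-moves : 1 ≤ k → 2 * k ≤ n → ∀ {d} → 0 < d → d < n → ∃ λ r → r < n × ¬ (Top r ⇔ Top ((r + d) % n))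
  Top-rotate-moves 1≤k 2k≤n {suc e} _ d<n with suc e ≤? n ∸ k
  ... | yes d≤n-k = n' , ≤-refl , λ top⇔ → <⇒≱ (m≤o∸n⇒m+n≤o (suc e) k≤n d≤n-k)
          (subst (λ z → n ≤ z + k) ([n'+1+e]%n≡e (<-trans (n<1+n e) d<n)) (Equivalence.to top⇔ (Top-n' 1≤k)))
    where
    k≤n : k ≤ n
    k≤n = ≤-trans (m≤n*m k 2) 2k≤n
  ... | no  d≰n-k = n' ∸ suc e , s≤s (m∸n≤m n' (suc e)) , λ top⇔ → <⇒≱ r+k<n
          (Equivalence.from top⇔ (subst Top (sym r+d≡n') (Top-n' 1≤k)))
    where
    open ≤-Reasoning
    d≤n' : suc e ≤ n'
    d≤n' = s≤s⁻¹ d<n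
    k≤d : k ≤ suc e
    k≤d = ≤-trans (m+n≤o⇒m≤o∸n k (subst (_≤ n) (cong (k +_) (+-identityʳ k)) 2k≤n)) (<⇒≤ (≰⇒> d≰n-k))
    r+k<n : n' ∸ suc e + k < n
    r+k<n = s≤s (begin
      n' ∸ suc e + k       ≤⟨ +-monoʳ-≤ (n' ∸ suc e) k≤d ⟩
      n' ∸ suc e + suc e   ≡⟨ m∸n+n≡m d≤n' ⟩
      n'                   ∎)
    r+d≡n' : (n' ∸ suc e + suc e) % n ≡ n'
    r+d≡n' = trans (cong (_% n) (m∸n+n≡m d≤n')) (m<n⇒m%n≡m ≤-refl)

  ∈mechanical-shift⇔ : ∀ {s d x} → x ∈ mechanical (s + d) ⇔ Top ((residue s (toℕ x) + d) % n)
  ∈mechanical-shift⇔ {s} {d} {x} = mk⇔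
    (λ x∈ → subst Top (residue-shift s d (toℕ x)) (Equivalence.to ∈mechanical⇔ x∈))
    (λ top → Equivalence.from ∈mechanical⇔ (subst Top (sym (residue-shift s d (toℕ x))) top))

  module _ (coprime : Coprime n k) (1≤k : 1 ≤ k) where

    mechanical-disjoint⇔ : k ≤ n → ∀ {s d} → s + d < n →
                           (k ≤ d × d ≤ n ∸ k) ⇔ Empty (mechanical s ∩ mechanical (s + d))
    mechanical-disjoint⇔ k≤n {s} {d} s+d<n = mk⇔ disjoint meets
      where
      disjoint : k ≤ d × d ≤ n ∸ k → Empty (mechanical s ∩ mechanical (s + d))
      disjoint (k≤d , d≤n-k) (x , x∈∩) with x∈p∩q⁻ (mechanical s) (mechanical (s + d)) x∈∩
      ... | x∈s , x∈s+d = Top-rotate-disjoint (m%n<n (toℕ x * k + s) n) k≤d (m≤o∸n⇒m+n≤o d k≤n d≤n-k)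
                            (Equivalence.to ∈mechanical⇔ x∈s) (Equivalence.to ∈mechanical-shift⇔ x∈s+d)
      meets : Empty (mechanical s ∩ mechanical (s + d)) → k ≤ d × d ≤ n ∸ k
      meets empty = decidable-stable (k ≤? d ×-dec d ≤? n ∸ k) λ ¬k≤d≤n-k →
        let r , r<n , top-r , top-r+d = Top-rotate-meets 1≤k k≤n (≤-<-trans (m≤n+m d s) s+d<n) ¬k≤d≤n-k
            x , res≡r                 = residue-surjective coprime (<⇒≤ (≤-<-trans (m≤m+n s d) s+d<n)) r<n
        in empty (x , x∈p∩q⁺ (Equivalence.from ∈mechanical⇔ (subst Top (sym res≡r) top-r)
                            , Equivalence.from ∈mechanical-shift⇔ (subst (λ z → Top ((z + d) % n)) (sym res≡r) top-r+d)))

    mechanical-shift-≢ : 2 * k ≤ n → ∀ {s d} → 0 < d → s + d < n → mechanical s ≢ mechanical (s + d)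
    mechanical-shift-≢ 2k≤n {s} {d} 0<d s+d<n s≡s+d =
      let r , r<n , ¬top⇔ = Top-rotate-moves 1≤k 2k≤n 0<d (≤-<-trans (m≤n+m d s) s+d<n)
          x , res≡r      = residue-surjective coprime (<⇒≤ (≤-<-trans (m≤m+n s d) s+d<n)) r<n
          x∈s⇔x∈s+d     : x ∈ mechanical s ⇔ x ∈ mechanical (s + d)
          x∈s⇔x∈s+d     = subst (λ V → x ∈ mechanical s ⇔ x ∈ V) s≡s+d ⇔.refl
      in ¬top⇔ (subst (λ z → Top z ⇔ Top ((z + d) % n)) res≡r
                  (⇔.trans (⇔.sym ∈mechanical⇔) (⇔.trans x∈s⇔x∈s+d ∈mechanical-shift⇔)))

    mechanical-<-≢ : 2 * k ≤ n → ∀ {s t} → s < t → t < n → mechanical s ≢ mechanical t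
    mechanical-<-≢ 2k≤n {s} {t} s<t t<n = subst (λ z → mechanical s ≢ mechanical z) s+[t∸s]≡t
      (mechanical-shift-≢ 2k≤n (m<n⇒0<n∸m s<t) (subst (_< n) (sym s+[t∸s]≡t) t<n))
      where
      s+[t∸s]≡t : s + (t ∸ s) ≡ t
      s+[t∸s]≡t = m+[n∸m]≡n (<⇒≤ s<t)

    mechanical-injective : 2 * k ≤ n → ∀ {s t} → s < n → t < n → mechanical s ≡ mechanical t → s ≡ t
    mechanical-injective 2k≤n {s} {t} s<n t<n s≡t with <-cmp s t
    ... | tri< s<t _ _ = ⊥-elim (mechanical-<-≢ 2k≤n s<t t<n s≡t)
    ... | tri≈ _ s≡t _ = s≡t
    ... | tri> _ _ t<s = ⊥-elim (mechanical-<-≢ 2k≤n t<s s<n (sym s≡t))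

    mechanical-adjacent⇔ : k ≤ n → ∀ {s t} → s ≤ t → t < n →
                           (k ≤ ∣ s - t ∣ × ∣ s - t ∣ ≤ n ∸ k) ⇔ Empty (mechanical s ∩ mechanical t)
    mechanical-adjacent⇔ k≤n {s} {t} s≤t t<n =
      subst₂ (λ d u → (k ≤ d × d ≤ n ∸ k) ⇔ Empty (mechanical s ∩ mechanical u))
             (sym (m≤n⇒∣m-n∣≡n∸m s≤t)) (m+[n∸m]≡n s≤t)
             (mechanical-disjoint⇔ k≤n (subst (_< n) (sym (m+[n∸m]≡n s≤t)) t<n))

    KAdj⇔QAdj : k ≤ n → ∀ i j → KAdj n k i j ⇔ QAdj (mechanical (toℕ i)) (mechanical (toℕ j))
    KAdj⇔QAdj k≤n i j with ≤-total (toℕ i) (toℕ j)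
    ... | inj₁ i≤j = mechanical-adjacent⇔ k≤n i≤j (toℕ<n j)
    ... | inj₂ j≤i = subst₂ (λ d V → (k ≤ d × d ≤ n ∸ k) ⇔ Empty V)
                            (∣-∣-comm (toℕ j) (toℕ i)) (∩-comm (mechanical (toℕ j)) (mechanical (toℕ i)))
                            (mechanical-adjacent⇔ k≤n j≤i (toℕ<n i))

module WellSpreadIsMechanical (n' k : ℕ) (k≤n : k ≤ suc n') (coprime : Coprime (suc n') k)
                              (U : Subset (suc n')) (∣U∣≡k : ∣ U ∣ ≡ k) (wsU : WellSpread U) where

  open Mechanical n' k

  F : ℕ → ℕ
  F = arcCount U 0

  A : ℕ → ℕ → ℕ
  A = arcCount U

  F[m*n]≡m*k : ∀ m → F (m * n) ≡ m * k
  F[m*n]≡m*k zero    = refl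
  F[m*n]≡m*k (suc m) = begin
    F (n + m * n)          ≡⟨ cong F (+-comm n (m * n)) ⟩
    F (m * n + n)          ≡⟨ arcCount-+ U 0 (m * n) n ⟩
    F (m * n) + A (m * n) n ≡⟨ cong₂ _+_ (F[m*n]≡m*k m) (arcCount-% U n (m*n%n≡0 m n)) ⟩
    m * k + F n            ≡⟨ cong (m * k +_) (trans (sym (∣U∣≡arcCount U)) ∣U∣≡k) ⟩
    m * k + k              ≡⟨ +-comm (m * k) k ⟩
    suc m * k              ∎
    where open ≡-Reasoning

  F[n*m]*n≡n*[m*k] : ∀ m → F (n * m) * n ≡ n * (m * k)
  F[n*m]*n≡n*[m*k] m = trans (cong (λ z → F z * n) (*-comm n m)) (trans (cong (_* n) (F[m*n]≡m*k m)) (*-comm (m * k) n))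

  A≤1+A : ∀ x y {m} → 1 ≤ m → m < n → A y m ≤ suc (A x m)
  A≤1+A x y {m} 1≤m m<n =
    ≤-trans (m≤∣m-n∣+n (A y m) (A x m)) (+-monoˡ-≤ (A x m) (subst₂ (λ a b → ∣ a - b ∣ ≤ 1) (A-% y) (A-% x) ws))
    where
    ws = wsU (fromℕ< (m%n<n y n)) (fromℕ< (m%n<n x n)) m 1≤m (s≤s⁻¹ m<n)
    A-% : ∀ z → A (toℕ (fromℕ< (m%n<n z n))) m ≡ A z m
    A-% z = trans (cong (λ i → A i m) (toℕ-fromℕ< (m%n<n z n))) (arcCount-% U m (m%n%n≡m%n z n))

  A*n≢m*k : ∀ x {m} → 1 ≤ m → m < n → A x m * n ≢ m * k
  A*n≢m*k x {suc m} _ m<n A*n≡m*k =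
    <⇒≱ m<n (∣⇒≤ (coprime-divisor coprime (divides (A x (suc m)) (trans (*-comm k (suc m)) (sym A*n≡m*k)))))

  A*n<m*k+n : ∀ x {m} → m < n → A x m * n < m * k + n
  A*n<m*k+n x {zero}  _   = s≤s z≤n
  A*n<m*k+n x {suc m} m<n = ≰⇒> λ m*k+n≤A*n → <⇒≱ (m<m+n (n * (M * k)) (s≤s z≤n)) (begin
    n * (M * k) + n   ≤⟨ arcCount-tiling-> U n (M * k) M n (λ y → m*k<A*n y m*k+n≤A*n) ⟩
    F (n * M) * n     ≡⟨ F[n*m]*n≡n*[m*k] M ⟩
    n * (M * k)       ∎)
    where
    open ≤-Reasoning
    M = suc m
    m*k<A*n : ∀ y → M * k + n ≤ A x M * n → M * k < A y M * n
    m*k<A*n y m*k+n≤A*n = ≤∧≢⇒< (+-cancelʳ-≤ n (M * k) (A y M * n) (begin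
      M * k + n         ≤⟨ m*k+n≤A*n ⟩
      A x M * n         ≤⟨ *-monoˡ-≤ n (A≤1+A y x (s≤s z≤n) m<n) ⟩
      suc (A y M) * n   ≡⟨ +-comm n (A y M * n) ⟩
      A y M * n + n     ∎)) (A*n≢m*k y (s≤s z≤n) m<n ∘ sym)

  m*k<A*n+n : ∀ x {m} → m < n → m * k < A x m * n + n
  m*k<A*n+n x {zero}  _   = s≤s z≤n
  m*k<A*n+n x {suc m} m<n = ≰⇒> λ A*n+n≤m*k → <⇒≱ (m<m+n (n * (M * k)) (s≤s z≤n)) (begin
    n * (M * k) + n   ≡⟨ cong (_+ n) (F[n*m]*n≡n*[m*k] M) ⟨
    F (n * M) * n + n ≤⟨ arcCount-tiling-< U n (M * k) M n (λ y → A*n<m*k y A*n+n≤m*k) ⟩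
    n * (M * k)       ∎)
    where
    open ≤-Reasoning
    M = suc m
    A*n<m*k : ∀ y → A x M * n + n ≤ M * k → A y M * n < M * k
    A*n<m*k y A*n+n≤m*k = ≤∧≢⇒< (begin
      A y M * n         ≤⟨ *-monoˡ-≤ n (A≤1+A x y (s≤s z≤n) m<n) ⟩
      suc (A x M) * n   ≡⟨ +-comm n (A x M * n) ⟩
      A x M * n + n     ≤⟨ A*n+n≤m*k ⟩
      M * k             ∎) (A*n≢m*k y (s≤s z≤n) m<n)

  gap : ∀ {x y} → x < n → y < n → F y * n + x * k < F x * n + y * k + n
  gap {x} {y} x<n y<n with ≤-total x y
  ... | inj₁ x≤y = subst (λ z → F z * n + x * k < F x * n + z * k + n) (m+[n∸m]≡n x≤y) (begin-strict
    F (x + m) * n + x * k           ≡⟨ cong (λ z → z * n + x * k) (arcCount-+ U 0 x m) ⟩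
    (F x + A x m) * n + x * k       ≡⟨ regroup (F x) (A x m) n (x * k) ⟩
    F x * n + x * k + A x m * n     <⟨ +-monoʳ-< (F x * n + x * k) (A*n<m*k+n x m<n) ⟩
    F x * n + x * k + (m * k + n)   ≡⟨ regroup′ (F x * n) x m k n ⟩
    F x * n + (x + m) * k + n       ∎)
    where
    open ≤-Reasoning
    m = y ∸ x
    m<n = ≤-<-trans (m∸n≤m y x) y<n
    regroup : ∀ f a n c → (f + a) * n + c ≡ f * n + c + a * n
    regroup = solve-∀
    regroup′ : ∀ f x m k n → f + x * k + (m * k + n) ≡ f + (x + m) * k + n
    regroup′ = solve-∀
  ... | inj₂ y≤x = subst (λ z → F y * n + z * k < F z * n + y * k + n) (m+[n∸m]≡n y≤x) (begin-strict
    F y * n + (y + m) * k           ≡⟨ regroup (F y * n) y m k ⟩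
    F y * n + y * k + m * k         <⟨ +-monoʳ-< (F y * n + y * k) (m*k<A*n+n y m<n) ⟩
    F y * n + y * k + (A y m * n + n) ≡⟨ regroup′ (F y) (A y m) n (y * k) ⟩
    (F y + A y m) * n + y * k + n   ≡⟨ cong (λ z → z * n + y * k + n) (arcCount-+ U 0 y m) ⟨
    F (y + m) * n + y * k + n       ∎)
    where
    open ≤-Reasoning
    m = x ∸ y
    m<n = ≤-<-trans (m∸n≤m x y) x<n
    regroup : ∀ f y m k → f + (y + m) * k ≡ f + y * k + m * k
    regroup = solve-∀
    regroup′ : ∀ f a n c → f * n + c + (a * n + n) ≡ (f + a) * n + c + n
    regroup′ = solve-∀

  offset : ℕ → ℕ
  offset y = F y * n ∸ y * k

  -- Opaque only to keep the type checker from unfolding the argmax whenever s is normalised.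
  opaque
    ymax : ℕ
    ymax = argmax offset 0 (upTo n)

    ymax<n : ymax < n
    ymax<n = argmax-all offset (s≤s z≤n) (all-upTo n)

    offset≤offset[ymax] : ∀ {y} → y < n → offset y ≤ offset ymax
    offset≤offset[ymax] y<n = All.lookup (f[xs]≤f[argmax] {f = offset} 0 (upTo n)) (∈-upTo⁺ y<n)

  s : ℕ
  s = offset ymax

  F*n≤s+x*k : ∀ {x} → x < n → F x * n ≤ s + x * k
  F*n≤s+x*k {x} x<n = begin
    F x * n              ≤⟨ m≤n+m∸n (F x * n) (x * k) ⟩
    x * k + offset x     ≤⟨ +-monoʳ-≤ (x * k) (offset≤offset[ymax] x<n) ⟩
    x * k + s            ≡⟨ +-comm (x * k) s ⟩
    s + x * k            ∎
    where open ≤-Reasoning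

  s+x*k<[1+F]*n : ∀ {x} → x < n → s + x * k < suc (F x) * n
  s+x*k<[1+F]*n {x} x<n with ymax * k ≤? F ymax * n
  ... | yes ymax*k≤F*n = +-cancelʳ-< (ymax * k) (s + x * k) (suc (F x) * n) (begin-strict
    s + x * k + ymax * k           ≡⟨ xy∙z≈xz∙y s (x * k) (ymax * k) ⟩
    s + ymax * k + x * k           ≡⟨ cong (_+ x * k) (m∸n+n≡m ymax*k≤F*n) ⟩
    F ymax * n + x * k             <⟨ gap x<n ymax<n ⟩
    F x * n + ymax * k + n         ≡⟨ regroup (F x * n) (ymax * k) n ⟩
    suc (F x) * n + ymax * k       ∎)
    where
    open ≤-Reasoning
    regroup : ∀ f c n → f + c + n ≡ n + f + c
    regroup = solve-∀
  ... | no  ymax*k≰F*n = begin-strict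
    s + x * k                      ≡⟨ cong (_+ x * k) (m≤n⇒m∸n≡0 (<⇒≤ (≰⇒> ymax*k≰F*n))) ⟩
    x * k                          <⟨ gap x<n (s≤s z≤n) ⟩
    F x * n + 0 + n                ≡⟨ trans (cong (_+ n) (+-identityʳ (F x * n))) (+-comm (F x * n) n) ⟩
    suc (F x) * n                  ∎
    where open ≤-Reasoning

  s<n : s < n
  s<n = subst₂ _<_ (+-identityʳ s) (+-identityʳ n) (s+x*k<[1+F]*n {0} (s≤s z≤n))

  F≡[s+x*k]/n : ∀ {x} → x ≤ n → F x ≡ (s + x * k) / n
  F≡[s+x*k]/n {x} x≤n with m≤n⇒m<n∨m≡n x≤n
  ... | inj₁ x<n  = sym (/-unique n (F x) (F*n≤s+x*k x<n) (s+x*k<[1+F]*n x<n))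
  ... | inj₂ refl = trans (sym (∣U∣≡arcCount U)) (trans ∣U∣≡k (sym ([r+n*k]/n≡k n k s<n)))

  wellSpread⇒mechanical : ∃ λ s → s < n × mechanical s ≡ U
  wellSpread⇒mechanical = s , s<n , ≡-by-prefixCounts (mechanical s) U prefixCounts
    where
    open ≡-Reasoning
    prefixCounts : ∀ x → x ≤ n → arcCount (mechanical s) 0 x ≡ F x
    prefixCounts x x≤n = begin
      arcCount (mechanical s) 0 x    ≡⟨ arcCount-mechanical k≤n s 0 x ⟩
      (s % n + x * k) / n            ≡⟨ cong (λ r → (r + x * k) / n) (m<n⇒m%n≡m s<n) ⟩
      (s + x * k) / n                ≡⟨ F≡[s+x*k]/n x≤n ⟨
      F x                            ∎

proposition23 : (n k : ℕ) → 1 ≤ k → 2 * k ≤ n → gcd n k ≡ 1 → QIsoK n k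
proposition23 zero    (suc k) _ () _
proposition23 (suc n') k 1≤k 2k≤n gcd≡1 = record
  { g           = mechanical ∘ toℕ
  ; g-vertex    = λ i → ∣mechanical∣ k≤n (toℕ<n i)
                      , mechanical-noCyclicConsecutive 2k≤n (toℕ i)
                      , mechanical-wellSpread k≤n (toℕ i)
  ; g-injective = λ i j → toℕ-injective ∘ mechanical-injective coprime 1≤k 2k≤n (toℕ<n i) (toℕ<n j)
  ; g-onto      = onto
  ; g-adj       = KAdj⇔QAdj coprime 1≤k k≤n
  }
  where
  open Mechanical n' k
  coprime : Coprime (suc n') k
  coprime = gcd≡1⇒coprime gcd≡1
  k≤n : k ≤ suc n'
  k≤n = ≤-trans (m≤n*m k 2) 2k≤n
  onto : ∀ U → IsQVertex (suc n') k U → ∃ λ i → mechanical (toℕ i) ≡ U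
  onto U (∣U∣≡k , _ , wsU) =
    let s , s<n , mechanical-s≡U = WellSpreadIsMechanical.wellSpread⇒mechanical n' k k≤n coprime U ∣U∣≡k wsU
    in fromℕ< s<n , trans (cong mechanical (toℕ-fromℕ< s<n)) mechanical-s≡U
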